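{- Let $k\ge 3$. If there exists a $(k-1)$-chromatic $3$-star system (of some order), then there exists a $k$-chromatic $3$-star system (of some order).
   Context: An $e$-star is the complete bipartite graph $K_{1,e}$. An $e$-star system of order $n$ is a pair $(V,\mathcal B)$ where $|V|=n$ and $\mathcal B$ is a set of $e$-stars (subgraphs of the complete graph $K_n$ on $V$) whose edge sets partition the edge set of $K_n$. An $e$-star system is $k$-colourable if $V$ can be partitioned into $k$ sets (colour classes) such that no star in $\mathcal B$ has all its vertices in the same class; it is $k$-chromatic if it is $k$-colourable but not $(k-1)$-colourable. -}

module Defs where

open import Data.Nat using (ℕ; suc; _∸_)
open import Data.Fin using (Fin)
open import Data.Fin.Properties using (_≟_)
open import Data.Bool using (Bool; true; false; _∨_; _∧_)
open import Data.List using (List; length; filter)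
open import Data.List.Relation.Unary.All using (All)
open import Data.List.Relation.Unary.Any using (Any)
open import Data.Product using (Σ; _×_; ∃-syntax)
open import Relation.Nullary using (¬_; Dec; does)
open import Relation.Binary.PropositionalEquality using (_≡_; _≢_)
open import Data.Bool using (T)
open import Data.Bool.Properties using (T?)

record Star3 (n : ℕ) : Set where
  constructor star
  field
    centre : Fin n
    leaf₁ leaf₂ leaf₃ : Fin n

open Star3 public

WellFormed : ∀ {n} → Star3 n → Set
WellFormed (star c a b d) =
  c ≢ a × c ≢ b × c ≢ d × a ≢ b × a ≢ d × b ≢ d

_==_ : ∀ {n} → Fin n → Fin n → Bool
x == y = does (x ≟ y)

isLeaf : ∀ {n} → Star3 n → Fin n → Bool
isLeaf (star c a b d) v = (v == a) ∨ (v == b) ∨ (v == d)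

hasEdge : ∀ {n} → Star3 n → Fin n → Fin n → Bool
hasEdge s u v = ((u == centre s) ∧ isLeaf s v) ∨ ((v == centre s) ∧ isLeaf s u)

record StarSystem3 (n : ℕ) : Set where
  field
    blocks    : List (Star3 n)
    wellFormed : All WellFormed blocks
    partition : ∀ (u v : Fin n) → u ≢ v →
                length (filter (λ s → T? (hasEdge s u v)) blocks) ≡ 1

open StarSystem3 public

-- A colouring of V = Fin n with k colours (a partition of V into k colour
-- classes, some possibly empty) is a map Fin n → Fin k.
Monochromatic : ∀ {n k} → (Fin n → Fin k) → Star3 n → Set
Monochromatic f (star c a b d) = f a ≡ f c × f b ≡ f c × f d ≡ f c

Colourable : ∀ {n} → StarSystem3 n → ℕ → Set
Colourable {n} S k =
  Σ (Fin n → Fin k) λ f → All (λ s → ¬ Monochromatic f s) (blocks S)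

Chromatic : ∀ {n} → StarSystem3 n → ℕ → Set
Chromatic S k = Colourable S k × ¬ Colourable S (k ∸ 1)

-- Let g be a proper (k-1)-colouring of a (k-1)-chromatic system S on V, and let D carry a
-- system with |D| > 2(k-1) (a power of a system of order 6). Put a copy of S over every index triple
-- i ∈ D³ and join each point p = (v , (a , b , d)) of V × D³ to D by stars whose leaf sets cut D into
-- triples, one of them {a , b , d}. Finally take six layers of the result: the copy of a star centred in
-- layer l has its leaves moved to other layers depending on l and on whether the star is monochromatic
-- under g, so that a new colour on the upper layers 0, 1, 3 and g (constant on D) on the lower layers is
-- a proper k-colouring. Conversely, given a (k-1)-colouring, by pigeonhole three points a, b, d of D
-- share a colour γ in layer 0; the join stars then forbid γ at the points (v , (a , b , d)) of layer 2,
-- where the copy of S indexed by (a , b , d) lies untwisted because g is proper, so S would be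
-- (k-2)-colourable.

module Submission where

open import Defs
open import Data.Nat using (ℕ; _≤_; _∸_)
open import Data.Product using (Σ; ∃-syntax)

open import Data.Bool using (Bool; true; false; T; _∧_; _∨_) renaming (_≟_ to _≟ᴮ_)
open import Data.Bool.Properties using (T?; T-∨; T-∧)
open import Data.Empty using (⊥; ⊥-elim)
open import Data.Fin as Fin using (Fin; zero; suc; punchOut)
open import Data.Fin.Patterns using (0F; 1F; 2F; 3F; 4F; 5F)
import Data.Fin.Properties as Finₚ
open import Data.List using (List; []; _∷_; _++_; map; concatMap; filter; length; tabulate)
open import Data.List.Membership.Propositional using (_∈_)
open import Data.List.Membership.Propositional.Properties
  using (∈-tabulate⁺; ∈-map⁺; ∈-++⁺ˡ; ∈-++⁺ʳ; ∈-concatMap⁺)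
import Data.List.Relation.Unary.Any as Any
open import Data.List.Relation.Unary.All as All using (All; []; _∷_)
open import Data.List.Relation.Unary.All.Properties using (tabulate⁺; map⁺; map⁻; ++⁺; concat⁺)
import Data.Nat as ℕ
open import Data.Nat using (_+_; _*_; _^_; _<_; z≤n; s≤s)
import Data.Nat.Properties as ℕₚ
open import Data.Product using (_×_; _,_; proj₁; proj₂)
open import Data.Product.Properties using (,-injectiveˡ; ,-injectiveʳ)
open import Data.Product.Function.NonDependent.Propositional using (_×-↔_; _×-⇔_)
open import Data.Sum using (_⊎_; inj₁; inj₂; [_,_]′)
open import Data.Sum.Properties using (inj₁-injective; inj₂-injective)
open import Data.Sum.Function.Propositional using (_⊎-↔_; _⊎-⇔_)
open import Function using (_∘_; _⇔_; mk⇔; _↔_; mk↔ₛ′; Inverse; Injection; Injective; Equivalence)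
open import Function.Properties.Equivalence using () renaming (trans to ⇔-trans)
open import Function.Properties.Inverse using (↔-refl; ↔-sym; ↔-trans; ↔⇒↣)
open import Relation.Binary.Definitions using (DecidableEquality)
open import Relation.Binary.PropositionalEquality
open import Relation.Nullary using (¬_; Dec; yes; no; does)
open import Relation.Nullary.Decidable using (_×-dec_; _⊎-dec_; _→-dec_; ¬?; map′; toWitness; dec-false)

∑ : {A : Set} → List A → (A → ℕ) → ℕ
∑ []       h = 0
∑ (x ∷ xs) h = h x + ∑ xs h

module _ {A : Set} where

  ∑-++ : ∀ (xs ys : List A) h → ∑ (xs ++ ys) h ≡ ∑ xs h + ∑ ys h
  ∑-++ []       ys h = refl
  ∑-++ (x ∷ xs) ys h = trans (cong (h x +_) (∑-++ xs ys h)) (sym (ℕₚ.+-assoc (h x) _ _))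

  ∑-congᴬ : ∀ {xs : List A} {h g} → All (λ x → h x ≡ g x) xs → ∑ xs h ≡ ∑ xs g
  ∑-congᴬ []       = refl
  ∑-congᴬ (e ∷ es) = cong₂ _+_ e (∑-congᴬ es)

  ∑-cong : ∀ (xs : List A) {h g} → (∀ x → h x ≡ g x) → ∑ xs h ≡ ∑ xs g
  ∑-cong xs e = ∑-congᴬ (All.universal e xs)

  ∑-zeroᴬ : ∀ {xs : List A} {h} → All (λ x → h x ≡ 0) xs → ∑ xs h ≡ 0
  ∑-zeroᴬ []       = refl
  ∑-zeroᴬ (e ∷ es) = cong₂ _+_ e (∑-zeroᴬ es)

  ∑-zero : ∀ (xs : List A) {h} → (∀ x → h x ≡ 0) → ∑ xs h ≡ 0
  ∑-zero xs e = ∑-zeroᴬ (All.universal e xs)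

∑-map : ∀ {A B : Set} (f : A → B) xs h → ∑ (map f xs) h ≡ ∑ xs (h ∘ f)
∑-map f []       h = refl
∑-map f (x ∷ xs) h = cong (h (f x) +_) (∑-map f xs h)

∑-concatMap : ∀ {A B : Set} (f : A → List B) xs h →
              ∑ (concatMap f xs) h ≡ ∑ xs (λ x → ∑ (f x) h)
∑-concatMap f []       h = refl
∑-concatMap f (x ∷ xs) h = trans (∑-++ (f x) _ h) (cong (∑ (f x) h +_) (∑-concatMap f xs h))

∑-tabulate-single : ∀ {A : Set} {n} (f : Fin n → A) h i₀ →
                    (∀ i → i ≢ i₀ → h (f i) ≡ 0) → ∑ (tabulate f) h ≡ h (f i₀)
∑-tabulate-single f h zero off =
  trans (cong (h (f zero) +_) (∑-zeroᴬ (tabulate⁺ (λ i → off (suc i) λ ())))) (ℕₚ.+-identityʳ _)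
∑-tabulate-single f h (suc i₀) off =
  trans (cong (_+ ∑ (tabulate (f ∘ suc)) h) (off zero λ ()))
        (∑-tabulate-single (f ∘ suc) h i₀ (λ i i≢i₀ → off (suc i) (i≢i₀ ∘ Finₚ.suc-injective)))

𝟙 : {P : Set} → Dec P → ℕ
𝟙 (yes _) = 1
𝟙 (no _)  = 0

module _ {P : Set} where

  𝟙-yes : (P? : Dec P) → P → 𝟙 P? ≡ 1
  𝟙-yes (yes _) _ = refl
  𝟙-yes (no ¬p) p = ⊥-elim (¬p p)

  𝟙-no : (P? : Dec P) → ¬ P → 𝟙 P? ≡ 0
  𝟙-no (yes p) ¬p = ⊥-elim (¬p p)
  𝟙-no (no _)  _  = refl

  𝟙-cong : ∀ {Q : Set} (P? : Dec P) (Q? : Dec Q) → P ⇔ Q → 𝟙 P? ≡ 𝟙 Q?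
  𝟙-cong P? (yes q) P⇔Q = 𝟙-yes P? (Equivalence.from P⇔Q q)
  𝟙-cong P? (no ¬q) P⇔Q = 𝟙-no P? (¬q ∘ Equivalence.to P⇔Q)

length-filter≡∑𝟙 : ∀ {A : Set} {P : A → Set} (P? : ∀ x → Dec (P x)) xs →
                   length (filter P? xs) ≡ ∑ xs (𝟙 ∘ P?)
length-filter≡∑𝟙 P? [] = refl
length-filter≡∑𝟙 P? (x ∷ xs) with P? x
... | yes _ = cong ℕ.suc (length-filter≡∑𝟙 P? xs)
... | no  _ = length-filter≡∑𝟙 P? xs

↔-injective : ∀ {A B : Set} (e : A ↔ B) → Injective _≡_ _≡_ (Inverse.to e)
↔-injective e = Injection.injective (↔⇒↣ e)

record FinType : Set₁ where
  field
    Carrier : Set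
    size    : ℕ
    index   : Carrier ↔ Fin size

open FinType public using (Carrier; size)

module _ (A : FinType) where
  open FinType A using (index)
  open Inverse index

  infix 4 _≟_
  _≟_ : DecidableEquality (Carrier A)
  x ≟ y = map′ (↔-injective index) (cong to) (to x Finₚ.≟ to y)

  enum : List (Carrier A)
  enum = tabulate from

  ∈-enum : ∀ x → x ∈ enum
  ∈-enum x = subst (_∈ enum) (strictlyInverseʳ x) (∈-tabulate⁺ (to x))

  ∑-enum-single : ∀ h x₀ → (∀ x → x ≢ x₀ → h x ≡ 0) → ∑ enum h ≡ h x₀
  ∑-enum-single h x₀ off =
    trans (∑-tabulate-single from h (to x₀) λ i i≢x₀ →
             off (from i) λ e → i≢x₀ (trans (sym (strictlyInverseˡ i)) (cong to e)))
          (cong h (strictlyInverseʳ x₀))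

  ∑-enum-𝟙-unique : ∀ {P : Carrier A → Set} (P? : ∀ x → Dec (P x)) x₀ →
                    P x₀ → (∀ x → P x → x ≡ x₀) → ∑ enum (𝟙 ∘ P?) ≡ 1
  ∑-enum-𝟙-unique P? x₀ p unique =
    trans (∑-enum-single (𝟙 ∘ P?) x₀ λ x x≢x₀ → 𝟙-no (P? x) (x≢x₀ ∘ unique x))
          (𝟙-yes (P? x₀) p)

finType : ℕ → FinType
finType n = record { Carrier = Fin n ; size = n ; index = ↔-refl }

infixr 2 _×ᶠ_
_×ᶠ_ : FinType → FinType → FinType
A ×ᶠ B = record
  { Carrier = Carrier A × Carrier B
  ; size    = size A * size B
  ; index   = ↔-trans (FinType.index A ×-↔ FinType.index B) (↔-sym Finₚ.*↔×)
  }

infixr 1 _⊎ᶠ_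
_⊎ᶠ_ : FinType → FinType → FinType
A ⊎ᶠ B = record
  { Carrier = Carrier A ⊎ Carrier B
  ; size    = size A + size B
  ; index   = ↔-trans (FinType.index A ⊎-↔ FinType.index B) (↔-sym Finₚ.+↔⊎)
  }

triple : ∀ {A : Set} → A → A → A → Fin 3 → A
triple a b d zero             = a
triple a b d (suc zero)       = b
triple a b d (suc (suc zero)) = d

module _ {A : Set} {a b d : A} where

  triple-injective : a ≢ b → a ≢ d → b ≢ d → Injective _≡_ _≡_ (triple a b d)
  triple-injective a≢b a≢d b≢d {zero}           {zero}           _ = refl
  triple-injective a≢b a≢d b≢d {zero}           {suc zero}       e = ⊥-elim (a≢b e)
  triple-injective a≢b a≢d b≢d {zero}           {suc (suc zero)} e = ⊥-elim (a≢d e)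
  triple-injective a≢b a≢d b≢d {suc zero}       {zero}           e = ⊥-elim (a≢b (sym e))
  triple-injective a≢b a≢d b≢d {suc zero}       {suc zero}       _ = refl
  triple-injective a≢b a≢d b≢d {suc zero}       {suc (suc zero)} e = ⊥-elim (b≢d e)
  triple-injective a≢b a≢d b≢d {suc (suc zero)} {zero}           e = ⊥-elim (a≢d (sym e))
  triple-injective a≢b a≢d b≢d {suc (suc zero)} {suc zero}       e = ⊥-elim (b≢d (sym e))
  triple-injective a≢b a≢d b≢d {suc (suc zero)} {suc (suc zero)} _ = refl

record Star (A : Set) : Set where
  field
    centre : A
    leaf   : Fin 3 → A

open Star public

mapStar : ∀ {A B : Set} → (A → B) → Star A → Star B
mapStar φ s = record { centre = φ (centre s) ; leaf = φ ∘ leaf s }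

module _ {A : Set} where

  IsLeaf : Star A → A → Set
  IsLeaf s v = ∃[ r ] v ≡ leaf s r

  Arm : Star A → A → A → Set
  Arm s u v = u ≡ centre s × IsLeaf s v

  Edge : Star A → A → A → Set
  Edge s u v = Arm s u v ⊎ Arm s v u

  IsK₁₃ : Star A → Set
  IsK₁₃ s = (∀ r → centre s ≢ leaf s r) × Injective _≡_ _≡_ (leaf s)

  IsMonochromatic : ∀ {k} → (A → Fin k) → Star A → Set
  IsMonochromatic c s = ∀ r → c (leaf s r) ≡ c (centre s)

  edge-sym : ∀ {s u v} → Edge s u v → Edge s v u
  edge-sym = Data.Sum.swap

  edge-endpoints : ∀ (P : A → Set) {s u v} → P (centre s) → (∀ r → P (leaf s r)) →
                   Edge s u v → P u × P v
  edge-endpoints P Pc Pl (inj₁ (refl , r , refl)) = Pc , Pl r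
  edge-endpoints P Pc Pl (inj₂ (refl , r , refl)) = Pl r , Pc

module _ {A B : Set} (φ : A → B) where

  edge-mapStar⁺ : ∀ {s u v} → Edge s u v → Edge (mapStar φ s) (φ u) (φ v)
  edge-mapStar⁺ (inj₁ (refl , r , refl)) = inj₁ (refl , r , refl)
  edge-mapStar⁺ (inj₂ (refl , r , refl)) = inj₂ (refl , r , refl)

  module _ (φ-injective : Injective _≡_ _≡_ φ) where

    edge-mapStar⁻ : ∀ {s u v} → Edge (mapStar φ s) (φ u) (φ v) → Edge s u v
    edge-mapStar⁻ (inj₁ (e , r , e′)) = inj₁ (φ-injective e , r , φ-injective e′)
    edge-mapStar⁻ (inj₂ (e , r , e′)) = inj₂ (φ-injective e , r , φ-injective e′)

    isK₁₃-mapStar : ∀ {s} → IsK₁₃ s → IsK₁₃ (mapStar φ s)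
    isK₁₃-mapStar (centre∉leaves , leaf-injective) =
      (λ r → centre∉leaves r ∘ φ-injective) , leaf-injective ∘ φ-injective

module EdgeCount (A : FinType) where

  isLeaf? : ∀ s v → Dec (IsLeaf s v)
  isLeaf? s v = Finₚ.any? (λ r → _≟_ A v (leaf s r))

  arm? : ∀ s u v → Dec (Arm s u v)
  arm? s u v = _≟_ A u (centre s) ×-dec isLeaf? s v

  edge? : ∀ s u v → Dec (Edge s u v)
  edge? s u v = arm? s u v ⊎-dec arm? s v u

  edgeCount : List (Star (Carrier A)) → Carrier A → Carrier A → ℕ
  edgeCount bs u v = ∑ bs (λ s → 𝟙 (edge? s u v))

  edgeCount-++ : ∀ xs ys u v → edgeCount (xs ++ ys) u v ≡ edgeCount xs u v + edgeCount ys u v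
  edgeCount-++ xs ys u v = ∑-++ xs ys _

  𝟙-edge-sym : ∀ s u v → 𝟙 (edge? s u v) ≡ 𝟙 (edge? s v u)
  𝟙-edge-sym s u v = 𝟙-cong (edge? s u v) (edge? s v u) (mk⇔ edge-sym edge-sym)

  edgeCount-sym : ∀ bs u v → edgeCount bs u v ≡ edgeCount bs v u
  edgeCount-sym bs u v = ∑-cong bs (λ s → 𝟙-edge-sym s u v)

open EdgeCount public using (edgeCount)

record StarSystem (A : FinType) : Set where
  field
    blocks    : List (Star (Carrier A))
    isK₁₃     : All IsK₁₃ blocks
    partition : ∀ u v → u ≢ v → edgeCount A blocks u v ≡ 1

open StarSystem public

Colouring : ∀ {A} → StarSystem A → ℕ → Set
Colouring {A} S k = Σ (Carrier A → Fin k) λ c → All (¬_ ∘ IsMonochromatic c) (blocks S)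

colouring-missing : ∀ {A} {S : StarSystem A} {m} (c : Carrier A → Fin (ℕ.suc m)) γ →
                    (∀ x → c x ≢ γ) → All (¬_ ∘ IsMonochromatic c) (blocks S) → Colouring S m
colouring-missing c γ c≢γ proper =
  (λ x → punchOut (c≢γ x ∘ sym)) ,
  All.map (λ {s} ¬mono mono → ¬mono λ r →
    Finₚ.punchOut-injective (c≢γ (leaf s r) ∘ sym) (c≢γ (centre s) ∘ sym) (mono r)) proper

fromStar3 : ∀ {n} → Star3 n → Star (Fin n)
fromStar3 s = record
  { centre = centre s
  ; leaf   = triple (leaf₁ s) (leaf₂ s) (leaf₃ s)
  }

toStar3 : ∀ {n} → Star (Fin n) → Star3 n
toStar3 s = star (centre s) (leaf s zero) (leaf s (suc zero)) (leaf s (suc (suc zero)))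

hasEdgeCount : ∀ {n} → List (Star3 n) → Fin n → Fin n → ℕ
hasEdgeCount bs u v = length (filter (λ t → T? (hasEdge t u v)) bs)

module _ {n : ℕ} where

  T-==⇔≡ : {x y : Fin n} → T (x == y) ⇔ x ≡ y
  T-==⇔≡ {x} {y} with x Finₚ.≟ y
  ... | yes x≡y = mk⇔ (λ _ → x≡y) _
  ... | no  x≢y = mk⇔ (λ ()) x≢y

  isLeaf⇔IsLeaf : ∀ (s : Star (Fin n)) v → T (isLeaf (toStar3 s) v) ⇔ IsLeaf s v
  isLeaf⇔IsLeaf s v = mk⇔ to from
    where
    to : T (isLeaf (toStar3 s) v) → IsLeaf s v
    to t with Equivalence.to T-∨ t
    ... | inj₁ t₀ = zero , Equivalence.to T-==⇔≡ t₀
    ... | inj₂ t₁₂ with Equivalence.to T-∨ t₁₂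
    ...   | inj₁ t₁ = suc zero , Equivalence.to T-==⇔≡ t₁
    ...   | inj₂ t₂ = suc (suc zero) , Equivalence.to T-==⇔≡ t₂
    is : Fin 3 → Bool
    is r = v == leaf s r
    ∨-intro₀ : T (is zero) ⊎ T (is (suc zero) ∨ is (suc (suc zero))) → T (isLeaf (toStar3 s) v)
    ∨-intro₀ = Equivalence.from (T-∨ {is zero})
    ∨-intro₁₂ : T (is (suc zero)) ⊎ T (is (suc (suc zero))) → T (is (suc zero) ∨ is (suc (suc zero)))
    ∨-intro₁₂ = Equivalence.from (T-∨ {is (suc zero)})
    from : IsLeaf s v → T (isLeaf (toStar3 s) v)
    from (zero , e)           = ∨-intro₀ (inj₁ (Equivalence.from T-==⇔≡ e))
    from (suc zero , e)       = ∨-intro₀ (inj₂ (∨-intro₁₂ (inj₁ (Equivalence.from T-==⇔≡ e))))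
    from (suc (suc zero) , e) = ∨-intro₀ (inj₂ (∨-intro₁₂ (inj₂ (Equivalence.from T-==⇔≡ e))))

  hasEdge⇔Edge : ∀ (s : Star (Fin n)) u v → T (hasEdge (toStar3 s) u v) ⇔ Edge s u v
  hasEdge⇔Edge s u v = ⇔-trans T-∨ (arm u v ⊎-⇔ arm v u)
    where
    arm : ∀ x y → T ((x == centre s) ∧ isLeaf (toStar3 s) y) ⇔ Arm s x y
    arm x y = ⇔-trans T-∧ (T-==⇔≡ ×-⇔ isLeaf⇔IsLeaf s y)

  hasEdgeCount≡edgeCount : ∀ (bs : List (Star (Fin n))) u v →
                           hasEdgeCount (map toStar3 bs) u v ≡ edgeCount (finType n) bs u v
  hasEdgeCount≡edgeCount bs u v = begin
    hasEdgeCount (map toStar3 bs) u v                   ≡⟨ length-filter≡∑𝟙 _ (map toStar3 bs) ⟩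
    ∑ (map toStar3 bs) (λ t → 𝟙 (T? (hasEdge t u v)))  ≡⟨ ∑-map toStar3 bs _ ⟩
    ∑ bs (λ s → 𝟙 (T? (hasEdge (toStar3 s) u v)))      ≡⟨ ∑-cong bs (λ s → 𝟙-cong _ _ (hasEdge⇔Edge s u v)) ⟩
    edgeCount (finType n) bs u v                        ∎
    where open ≡-Reasoning

  isK₁₃-fromStar3 : ∀ {s : Star3 n} → WellFormed s → IsK₁₃ (fromStar3 s)
  isK₁₃-fromStar3 (c≢a , c≢b , c≢d , a≢b , a≢d , b≢d) =
    (λ { zero → c≢a ; (suc zero) → c≢b ; (suc (suc zero)) → c≢d }) , triple-injective a≢b a≢d b≢d

  wellFormed-toStar3 : ∀ {s : Star (Fin n)} → IsK₁₃ s → WellFormed (toStar3 s)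
  wellFormed-toStar3 (centre∉leaves , leaf-injective) =
    centre∉leaves zero , centre∉leaves (suc zero) , centre∉leaves (suc (suc zero)) ,
    (λ ()) ∘ leaf-injective , (λ ()) ∘ leaf-injective , (λ ()) ∘ leaf-injective

  monochromatic⇔ : ∀ {k} (c : Fin n → Fin k) s → Monochromatic c (toStar3 s) ⇔ IsMonochromatic c s
  monochromatic⇔ c s = mk⇔
    (λ { (e₀ , _ , _) zero → e₀ ; (_ , e₁ , _) (suc zero) → e₁ ; (_ , _ , e₂) (suc (suc zero)) → e₂ })
    (λ m → m zero , m (suc zero) , m (suc (suc zero)))

  toStar3∘fromStar3 : ∀ (bs : List (Star3 n)) → map toStar3 (map fromStar3 bs) ≡ bs
  toStar3∘fromStar3 []       = refl
  toStar3∘fromStar3 (b ∷ bs) = cong (b ∷_) (toStar3∘fromStar3 bs)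

  fromStarSystem3 : StarSystem3 n → StarSystem (finType n)
  fromStarSystem3 S = record
    { blocks    = map fromStar3 (blocks S)
    ; isK₁₃     = map⁺ (All.map isK₁₃-fromStar3 (wellFormed S))
    ; partition = λ u v u≢v → begin
        edgeCount (finType n) (map fromStar3 (blocks S)) u v
          ≡⟨ hasEdgeCount≡edgeCount (map fromStar3 (blocks S)) u v ⟨
        hasEdgeCount (map toStar3 (map fromStar3 (blocks S))) u v
          ≡⟨ cong (λ bs → hasEdgeCount bs u v) (toStar3∘fromStar3 (blocks S)) ⟩
        hasEdgeCount (blocks S) u v
          ≡⟨ partition S u v u≢v ⟩
        1 ∎
    }
    where open ≡-Reasoning

  asStarSystem3 : StarSystem (finType n) → StarSystem3 n
  asStarSystem3 S = record
    { blocks     = map toStar3 (blocks S)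
    ; wellFormed = map⁺ (All.map wellFormed-toStar3 (isK₁₃ S))
    ; partition  = λ u v u≢v → trans (hasEdgeCount≡edgeCount (blocks S) u v) (partition S u v u≢v)
    }

  colouring-fromStarSystem3 : ∀ {S k} → Colourable S k → Colouring (fromStarSystem3 S) k
  colouring-fromStarSystem3 (c , proper) =
    c , map⁺ (All.map (λ {s} ¬mono → ¬mono ∘ Equivalence.from (monochromatic⇔ c (fromStar3 s))) proper)

  colourable-fromStarSystem3 : ∀ {S k} → Colouring (fromStarSystem3 S) k → Colourable S k
  colourable-fromStarSystem3 {S} (c , proper) =
    c , All.map (λ {s} ¬mono → ¬mono ∘ Equivalence.to (monochromatic⇔ c (fromStar3 s))) (map⁻ proper)

  colourable-asStarSystem3 : ∀ {S k} → Colouring S k → Colourable (asStarSystem3 S) k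
  colourable-asStarSystem3 (c , proper) =
    c , map⁺ (All.map (λ {s} ¬mono → ¬mono ∘ Equivalence.to (monochromatic⇔ c s)) proper)

  colouring-asStarSystem3 : ∀ {S k} → Colourable (asStarSystem3 S) k → Colouring S k
  colouring-asStarSystem3 (c , proper) =
    c , All.map (λ {s} ¬mono → ¬mono ∘ Equivalence.from (monochromatic⇔ c s)) (map⁻ proper)

module _ {A B : FinType} (φ : Carrier A → Carrier B) (φ-injective : Injective _≡_ _≡_ φ) where

  edgeCount-mapStar : ∀ bs u v → edgeCount B (map (mapStar φ) bs) (φ u) (φ v) ≡ edgeCount A bs u v
  edgeCount-mapStar bs u v = trans (∑-map _ bs _) (∑-cong bs λ s →
    𝟙-cong _ _ (mk⇔ (edge-mapStar⁻ φ φ-injective) (edge-mapStar⁺ φ)))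

  edgeCount-mapStar-outside : ∀ bs u v → (∀ x → v ≢ φ x) → edgeCount B (map (mapStar φ) bs) u v ≡ 0
  edgeCount-mapStar-outside bs u v v∉φ = trans (∑-map _ bs _) (∑-zero bs λ s → 𝟙-no _ λ ed →
    let (x , v≡φx) = proj₂ (edge-endpoints (λ y → ∃[ x ] y ≡ φ x) (_ , refl) (λ r → _ , refl) ed)
    in v∉φ x v≡φx)

module _ {A B : FinType} (e : Carrier A ↔ Carrier B) where
  open Inverse e

  edgeCount-relabel : ∀ bs u v → edgeCount B (map (mapStar to) bs) u v ≡ edgeCount A bs (from u) (from v)
  edgeCount-relabel bs u v =
    subst₂ (λ x y → edgeCount B (map (mapStar to) bs) x y ≡ edgeCount A bs (from u) (from v))
           (strictlyInverseˡ u) (strictlyInverseˡ v)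
           (edgeCount-mapStar {A} {B} to (↔-injective e) bs (from u) (from v))

  relabel : StarSystem A → StarSystem B
  relabel S = record
    { blocks    = map (mapStar to) (blocks S)
    ; isK₁₃     = map⁺ (All.map (isK₁₃-mapStar to (↔-injective e)) (isK₁₃ S))
    ; partition = λ u v u≢v → trans (edgeCount-relabel (blocks S) u v)
                                    (partition S (from u) (from v) (u≢v ∘ ↔-injective (↔-sym e)))
    }

  colouring-relabel : ∀ {S k} → Colouring S k → Colouring (relabel S) k
  colouring-relabel (c , proper) = c ∘ from , map⁺ (All.map (λ {s} ¬mono mono → ¬mono λ r →
    subst₂ (λ x y → c x ≡ c y) (strictlyInverseʳ (leaf s r)) (strictlyInverseʳ (centre s)) (mono r)) proper)

  colouring-unrelabel : ∀ {S k} → Colouring (relabel S) k → Colouring S k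
  colouring-unrelabel (c , proper) = c ∘ to , map⁻ proper

module _ {A : FinType} where

  private
    index = FinType.index A

  toStarSystem3 : StarSystem A → StarSystem3 (size A)
  toStarSystem3 = asStarSystem3 ∘ relabel {B = finType (size A)} index

  colourable-toStarSystem3 : ∀ {S k} → Colouring S k → Colourable (toStarSystem3 S) k
  colourable-toStarSystem3 {S} =
    colourable-asStarSystem3 {S = relabel index S} ∘ colouring-relabel {B = finType (size A)} index {S}

  colouring-toStarSystem3 : ∀ {S k} → Colourable (toStarSystem3 S) k → Colouring S k
  colouring-toStarSystem3 {S} =
    colouring-unrelabel {B = finType (size A)} index {S} ∘ colouring-asStarSystem3 {S = relabel index S}


-- Twisted products

isK₁₃⇒¬loop : ∀ {A : Set} {s : Star A} {u} → IsK₁₃ s → ¬ Edge s u u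
isK₁₃⇒¬loop (centre∉leaves , _) (inj₁ (refl , r , e)) = centre∉leaves r e
isK₁₃⇒¬loop (centre∉leaves , _) (inj₂ (refl , r , e)) = centre∉leaves r e

module TwistedProduct {A B : FinType} (Q : StarSystem A) (R : StarSystem B)
                      (twist : Star (Carrier A) → Carrier B → Fin 3 → Carrier B ↔ Carrier B) where

  private
    AB = A ×ᶠ B
    BB = B ×ᶠ B
    module EA  = EdgeCount A
    module EAB = EdgeCount AB

  open Inverse using (to; from; strictlyInverseˡ; strictlyInverseʳ)

  twistedStar : Star (Carrier A) → Carrier B × Carrier B → Star (Carrier A × Carrier B)
  twistedStar b ww = record
    { centre = centre b , proj₁ ww
    ; leaf   = λ r → leaf b r , to (twist b (proj₁ ww) r) (proj₂ ww)
    }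

  fibreStar : Carrier A → Star (Carrier B) → Star (Carrier A × Carrier B)
  fibreStar u = mapStar (u ,_)

  twistedStars fibreStars : List (Star (Carrier A × Carrier B))
  twistedStars = concatMap (λ b → map (twistedStar b) (enum BB)) (blocks Q)
  fibreStars   = concatMap (λ u → map (fibreStar u) (blocks R)) (enum A)

  isK₁₃-twistedStar : ∀ {b} ww → IsK₁₃ b → IsK₁₃ (twistedStar b ww)
  isK₁₃-twistedStar ww (centre∉leaves , leaf-injective) =
    (λ r → centre∉leaves r ∘ ,-injectiveˡ) , leaf-injective ∘ ,-injectiveˡ

  fibreCount-same : ∀ u w₁ w₂ →
                    edgeCount AB fibreStars (u , w₁) (u , w₂) ≡ edgeCount B (blocks R) w₁ w₂
  fibreCount-same u w₁ w₂ =
    trans (∑-concatMap _ (enum A) _) (trans (∑-enum-single A _ u off) (trans (∑-map _ (blocks R) _)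
      (∑-cong (blocks R) λ r →
        𝟙-cong _ _ (mk⇔ (edge-mapStar⁻ (u ,_) ,-injectiveʳ) (edge-mapStar⁺ (u ,_))))))
    where
    off : ∀ u′ → u′ ≢ u → edgeCount AB (map (fibreStar u′) (blocks R)) (u , w₁) (u , w₂) ≡ 0
    off u′ u′≢u = trans (∑-map _ (blocks R) _) (∑-zero (blocks R) λ r → 𝟙-no _ λ ed →
      u′≢u (sym (proj₁ (edge-endpoints (λ p → proj₁ p ≡ u′) refl (λ _ → refl) ed))))

  fibreCount-across : ∀ {u₁ u₂} w₁ w₂ → u₁ ≢ u₂ →
                      edgeCount AB fibreStars (u₁ , w₁) (u₂ , w₂) ≡ 0
  fibreCount-across w₁ w₂ u₁≢u₂ =
    trans (∑-concatMap _ (enum A) _) (∑-zero (enum A) λ u →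
      trans (∑-map _ (blocks R) _) (∑-zero (blocks R) λ r → 𝟙-no _ λ ed →
        let (u₁≡u , u₂≡u) = edge-endpoints (λ p → proj₁ p ≡ u) refl (λ _ → refl) ed
        in u₁≢u₂ (trans u₁≡u (sym u₂≡u))))

  twistedCount-same : ∀ u w₁ w₂ → edgeCount AB twistedStars (u , w₁) (u , w₂) ≡ 0
  twistedCount-same u w₁ w₂ =
    trans (∑-concatMap _ (blocks Q) _) (∑-zeroᴬ (All.map (λ b-K₁₃ →
      trans (∑-map _ (enum BB) _) (∑-zero (enum BB) λ ww →
        𝟙-no _ (isK₁₃⇒¬loop b-K₁₃ ∘ edge-mapStar⁺ proj₁))) (isK₁₃ Q)))

  -- The copy of the arm is pinned down by its centre layer w₁ and by inverting the twist on w₂.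
  armCopies : ∀ {b u₁ u₂} w₁ w₂ → IsK₁₃ b → Arm b u₁ u₂ →
              ∑ (enum BB) (λ ww → 𝟙 (EAB.edge? (twistedStar b ww) (u₁ , w₁) (u₂ , w₂))) ≡ 1
  armCopies {b} w₁ w₂ (centre∉leaves , leaf-injective) (refl , r , refl) =
    ∑-enum-𝟙-unique BB _ (w₁ , from (twist b w₁ r) w₂) hit unique
    where
    hit : Edge (twistedStar b (w₁ , from (twist b w₁ r) w₂)) (centre b , w₁) (leaf b r , w₂)
    hit = inj₁ (refl , r , cong (leaf b r ,_) (sym (strictlyInverseˡ (twist b w₁ r) w₂)))
    unique : ∀ ww → Edge (twistedStar b ww) (centre b , w₁) (leaf b r , w₂) →
             ww ≡ (w₁ , from (twist b w₁ r) w₂)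
    unique (w , w′) (inj₁ (refl , r′ , e)) with leaf-injective (,-injectiveˡ e)
    ... | refl = cong (w ,_) (sym (trans (cong (from (twist b w r)) (,-injectiveʳ e))
                                         (strictlyInverseʳ (twist b w r) w′)))
    unique (w , w′) (inj₂ (e , _)) = ⊥-elim (centre∉leaves r (sym (,-injectiveˡ e)))

  twistedCopiesCount : ∀ {b u₁ u₂} w₁ w₂ → IsK₁₃ b → u₁ ≢ u₂ →
    edgeCount AB (map (twistedStar b) (enum BB)) (u₁ , w₁) (u₂ , w₂) ≡ 𝟙 (EA.edge? b u₁ u₂)
  twistedCopiesCount {b} {u₁} {u₂} w₁ w₂ b-K₁₃ u₁≢u₂ with EA.edge? b u₁ u₂
  ... | no ¬edge       = trans (∑-map _ (enum BB) _)
                               (∑-zero (enum BB) λ ww → 𝟙-no _ (¬edge ∘ edge-mapStar⁺ proj₁))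
  ... | yes (inj₁ arm) = trans (∑-map _ (enum BB) _) (armCopies w₁ w₂ b-K₁₃ arm)
  ... | yes (inj₂ arm) = trans (∑-map _ (enum BB) _)
    (trans (∑-cong (enum BB) λ ww → EAB.𝟙-edge-sym (twistedStar b ww) _ _) (armCopies w₂ w₁ b-K₁₃ arm))

  twistedCount-across : ∀ {u₁ u₂} w₁ w₂ → u₁ ≢ u₂ →
                        edgeCount AB twistedStars (u₁ , w₁) (u₂ , w₂) ≡ edgeCount A (blocks Q) u₁ u₂
  twistedCount-across w₁ w₂ u₁≢u₂ = trans (∑-concatMap _ (blocks Q) _)
    (∑-congᴬ (All.map (λ b-K₁₃ → twistedCopiesCount w₁ w₂ b-K₁₃ u₁≢u₂) (isK₁₃ Q)))

  partitionᵀ : ∀ p₁ p₂ → p₁ ≢ p₂ → edgeCount AB (twistedStars ++ fibreStars) p₁ p₂ ≡ 1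
  partitionᵀ p₁@(u₁ , w₁) p₂@(u₂ , w₂) p₁≢p₂ =
    trans (EAB.edgeCount-++ twistedStars fibreStars p₁ p₂) (split (_≟_ A u₁ u₂))
    where
    split : Dec (u₁ ≡ u₂) → edgeCount AB twistedStars p₁ p₂ + edgeCount AB fibreStars p₁ p₂ ≡ 1
    split (yes refl) = trans (cong₂ _+_ (twistedCount-same u₁ w₁ w₂) (fibreCount-same u₁ w₁ w₂))
                             (partition R w₁ w₂ (p₁≢p₂ ∘ cong (u₁ ,_)))
    split (no u₁≢u₂) = trans (cong₂ _+_ (twistedCount-across w₁ w₂ u₁≢u₂)
                                         (fibreCount-across w₁ w₂ u₁≢u₂))
                             (trans (ℕₚ.+-identityʳ _) (partition Q u₁ u₂ u₁≢u₂))

  system : StarSystem AB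
  system = record
    { blocks    = twistedStars ++ fibreStars
    ; isK₁₃     = ++⁺ (concat⁺ (map⁺ (All.map (λ b-K₁₃ →
                          map⁺ (All.universal (λ ww → isK₁₃-twistedStar ww b-K₁₃) (enum BB)))
                        (isK₁₃ Q))))
                      (concat⁺ (map⁺ (All.universal (λ u →
                          map⁺ (All.map (isK₁₃-mapStar (u ,_) ,-injectiveʳ) (isK₁₃ R))) (enum A))))
    ; partition = partitionᵀ
    }

  twistedStar-∈ : ∀ {b} → b ∈ blocks Q → ∀ ww → twistedStar b ww ∈ blocks system
  twistedStar-∈ b∈ ww = ∈-++⁺ˡ (∈-concatMap⁺ (λ b → map (twistedStar b) (enum BB))
    (Any.map (λ { refl → ∈-map⁺ (twistedStar _) (∈-enum BB ww) }) b∈))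

infixr 2 _⊗_
_⊗_ : ∀ {A B} → StarSystem A → StarSystem B → StarSystem (A ×ᶠ B)
Q ⊗ R = TwistedProduct.system Q R (λ _ _ _ → ↔-refl)

-- Joining two systems by stars from one side to the other

module Join {P D T : FinType} (S₁ : StarSystem P) (S₂ : StarSystem D)
            (resolution : Carrier P → (Carrier T × Fin 3) ↔ Carrier D) where

  private
    PD = P ⊎ᶠ D
    PT = P ×ᶠ T
    module EPD = EdgeCount PD

  open Inverse using (to; from; strictlyInverseˡ; strictlyInverseʳ)

  crossStar : Carrier P × Carrier T → Star (Carrier P ⊎ Carrier D)
  crossStar pt = record
    { centre = inj₁ (proj₁ pt)
    ; leaf   = λ r → inj₂ (to (resolution (proj₁ pt)) (proj₂ pt , r))
    }

  leftStars rightStars crossStars starsᴶ : List (Star (Carrier P ⊎ Carrier D))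
  leftStars  = map (mapStar inj₁) (blocks S₁)
  rightStars = map (mapStar inj₂) (blocks S₂)
  crossStars = map crossStar (enum PT)
  starsᴶ     = leftStars ++ rightStars ++ crossStars

  isK₁₃-crossStar : ∀ pt → IsK₁₃ (crossStar pt)
  isK₁₃-crossStar (p , t) = (λ r ()) , ,-injectiveʳ ∘ ↔-injective (resolution p) ∘ inj₂-injective

  leftCount : ∀ p p′ → edgeCount PD leftStars (inj₁ p) (inj₁ p′) ≡ edgeCount P (blocks S₁) p p′
  leftCount = edgeCount-mapStar {P} {PD} inj₁ inj₁-injective (blocks S₁)

  rightCount : ∀ d d′ → edgeCount PD rightStars (inj₂ d) (inj₂ d′) ≡ edgeCount D (blocks S₂) d d′
  rightCount = edgeCount-mapStar {D} {PD} inj₂ inj₂-injective (blocks S₂)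

  leftCount-right : ∀ u d → edgeCount PD leftStars u (inj₂ d) ≡ 0
  leftCount-right u d = edgeCount-mapStar-outside {P} {PD} inj₁ inj₁-injective (blocks S₁) u _ λ _ ()

  rightCount-left : ∀ u p → edgeCount PD rightStars u (inj₁ p) ≡ 0
  rightCount-left u p = edgeCount-mapStar-outside {D} {PD} inj₂ inj₂-injective (blocks S₂) u _ λ _ ()

  crossCount-left : ∀ p p′ → edgeCount PD crossStars (inj₁ p) (inj₁ p′) ≡ 0
  crossCount-left p p′ = trans (∑-map _ (enum PT) _) (∑-zero (enum PT) λ pt →
    𝟙-no _ λ { (inj₁ (_ , _ , ())) ; (inj₂ (_ , _ , ())) })

  crossCount-right : ∀ d d′ → edgeCount PD crossStars (inj₂ d) (inj₂ d′) ≡ 0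
  crossCount-right d d′ = trans (∑-map _ (enum PT) _) (∑-zero (enum PT) λ pt →
    𝟙-no _ λ { (inj₁ (() , _)) ; (inj₂ (() , _)) })

  -- The unique cross star through p and d is indexed by the triple of the resolution of p containing d.
  crossCount-across : ∀ p d → edgeCount PD crossStars (inj₁ p) (inj₂ d) ≡ 1
  crossCount-across p d = trans (∑-map _ (enum PT) _)
    (∑-enum-𝟙-unique PT _ (p , proj₁ (from (resolution p) d)) hit unique)
    where
    hit : Edge (crossStar (p , proj₁ (from (resolution p) d))) (inj₁ p) (inj₂ d)
    hit = inj₁ (refl , proj₂ (from (resolution p) d) , cong inj₂ (sym (strictlyInverseˡ (resolution p) d)))
    unique : ∀ pt → Edge (crossStar pt) (inj₁ p) (inj₂ d) → pt ≡ (p , proj₁ (from (resolution p) d))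
    unique (p , t) (inj₁ (refl , r , e)) = cong (p ,_) (sym (,-injectiveˡ (begin
      from (resolution p) d                            ≡⟨ cong (from (resolution p)) (inj₂-injective e) ⟩
      from (resolution p) (to (resolution p) (t , r))  ≡⟨ strictlyInverseʳ (resolution p) (t , r) ⟩
      (t , r)                                          ∎)))
      where open ≡-Reasoning
    unique pt (inj₂ (() , _))

  edgeCountᴶ : ∀ u v → edgeCount PD starsᴶ u v ≡
               edgeCount PD leftStars u v + (edgeCount PD rightStars u v + edgeCount PD crossStars u v)
  edgeCountᴶ u v = trans (EPD.edgeCount-++ leftStars _ u v)
                         (cong (edgeCount PD leftStars u v +_) (EPD.edgeCount-++ rightStars _ u v))

  partitionᴶ : ∀ u v → u ≢ v → edgeCount PD starsᴶ u v ≡ 1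
  partitionᴶ (inj₁ p) (inj₁ p′) u≢v = trans (edgeCountᴶ (inj₁ p) (inj₁ p′))
    (trans (cong₂ _+_ (leftCount p p′) (cong₂ _+_ (rightCount-left (inj₁ p) p′) (crossCount-left p p′)))
           (trans (ℕₚ.+-identityʳ _) (partition S₁ p p′ (u≢v ∘ cong inj₁))))
  partitionᴶ (inj₂ d) (inj₂ d′) u≢v = trans (edgeCountᴶ (inj₂ d) (inj₂ d′))
    (trans (cong₂ _+_ (leftCount-right (inj₂ d) d′) (cong₂ _+_ (rightCount d d′) (crossCount-right d d′)))
           (trans (ℕₚ.+-identityʳ _) (partition S₂ d d′ (u≢v ∘ cong inj₂))))
  partitionᴶ (inj₁ p) (inj₂ d) _ = trans (edgeCountᴶ (inj₁ p) (inj₂ d))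
    (cong₂ _+_ (leftCount-right (inj₁ p) d)
               (cong₂ _+_ (trans (EPD.edgeCount-sym rightStars (inj₁ p) (inj₂ d)) (rightCount-left (inj₂ d) p))
                          (crossCount-across p d)))
  partitionᴶ (inj₂ d) (inj₁ p) u≢v =
    trans (EPD.edgeCount-sym starsᴶ (inj₂ d) (inj₁ p)) (partitionᴶ (inj₁ p) (inj₂ d) (u≢v ∘ sym))

  system : StarSystem PD
  system = record
    { blocks    = starsᴶ
    ; isK₁₃     = ++⁺ (map⁺ (All.map (isK₁₃-mapStar inj₁ inj₁-injective) (isK₁₃ S₁)))
                      (++⁺ (map⁺ (All.map (isK₁₃-mapStar inj₂ inj₂-injective) (isK₁₃ S₂)))
                           (map⁺ (All.universal isK₁₃-crossStar (enum PT))))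
    ; partition = partitionᴶ
    }

  leftStar-∈ : ∀ {b} → b ∈ blocks S₁ → mapStar inj₁ b ∈ blocks system
  leftStar-∈ b∈ = ∈-++⁺ˡ (∈-map⁺ (mapStar inj₁) b∈)

  crossStar-∈ : ∀ pt → crossStar pt ∈ blocks system
  crossStar-∈ pt = ∈-++⁺ʳ leftStars (∈-++⁺ʳ rightStars (∈-map⁺ crossStar (∈-enum PT pt)))

-- Permutations and a pigeonhole principle for triples

module Transposition {A : Set} (_≟_ : DecidableEquality A) where

  swap : A → A → A → A
  swap x y z with z ≟ x
  ... | yes _ = y
  ... | no  _ with z ≟ y
  ...   | yes _ = x
  ...   | no  _ = z

  swap-matchˡ : ∀ x y → swap x y x ≡ y
  swap-matchˡ x y with x ≟ x
  ... | yes _   = refl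
  ... | no  x≢x = ⊥-elim (x≢x refl)

  swap-matchʳ : ∀ x y → swap x y y ≡ x
  swap-matchʳ x y with y ≟ x
  ... | yes y≡x = y≡x
  ... | no  _ with y ≟ y
  ...   | yes _   = refl
  ...   | no  y≢y = ⊥-elim (y≢y refl)

  swap-fix : ∀ {x y z} → z ≢ x → z ≢ y → swap x y z ≡ z
  swap-fix {x} {y} {z} z≢x z≢y with z ≟ x
  ... | yes z≡x = ⊥-elim (z≢x z≡x)
  ... | no  _ with z ≟ y
  ...   | yes z≡y = ⊥-elim (z≢y z≡y)
  ...   | no  _   = refl

  swap-involutive : ∀ x y z → swap x y (swap x y z) ≡ z
  swap-involutive x y z with z ≟ x
  ... | yes refl = swap-matchʳ z y
  ... | no  z≢x with z ≟ y
  ...   | yes refl = swap-matchˡ x z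
  ...   | no  z≢y  = swap-fix z≢x z≢y

  transposition : A → A → A ↔ A
  transposition x y = mk↔ₛ′ (swap x y) (swap x y) (swap-involutive x y) (swap-involutive x y)

  open Inverse using (to; from)

  opaque
    redirect : A ↔ A → A → A → A ↔ A
    redirect π x a = ↔-trans (transposition x (from π a)) π

    redirect-sends : ∀ π x a → to (redirect π x a) x ≡ a
    redirect-sends π x a = trans (cong (to π) (swap-matchˡ x (from π a))) (Inverse.strictlyInverseˡ π a)

    redirect-keeps : ∀ π {x a z} → z ≢ x → to π z ≢ a → to (redirect π x a) z ≡ to π z
    redirect-keeps π {x} {a} z≢x πz≢a = cong (to π) (swap-fix z≢x λ z≡π⁻¹a →
      πz≢a (trans (cong (to π) z≡π⁻¹a) (Inverse.strictlyInverseˡ π a)))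

  sendTriple : (Fin 3 → A) → (Fin 3 → A) → A ↔ A
  sendTriple x a = redirect (redirect (redirect ↔-refl (x zero) (a zero)) (x (suc zero)) (a (suc zero)))
                            (x (suc (suc zero))) (a (suc (suc zero)))

  sendTriple-sends : ∀ {x a} → Injective _≡_ _≡_ x → Injective _≡_ _≡_ a →
                     ∀ r → to (sendTriple x a) (x r) ≡ a r
  sendTriple-sends {x} {a} x-inj a-inj r = sends r
    where
    π₁ = redirect ↔-refl (x zero) (a zero)
    π₂ = redirect π₁ (x (suc zero)) (a (suc zero))
    x≢ : ∀ {r r′} → r ≢ r′ → x r ≢ x r′
    x≢ r≢r′ = r≢r′ ∘ x-inj
    a≢ : ∀ {r r′} → r ≢ r′ → a r ≢ a r′
    a≢ r≢r′ = r≢r′ ∘ a-inj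
    keeps : ∀ π {r r′} → r ≢ r′ → to π (x r) ≡ a r → to (redirect π (x r′) (a r′)) (x r) ≡ a r
    keeps π r≢r′ πx≡a = trans (redirect-keeps π (x≢ r≢r′) λ e → a≢ r≢r′ (trans (sym πx≡a) e)) πx≡a
    sends : ∀ r → to (sendTriple x a) (x r) ≡ a r
    sends zero             = keeps π₂ (λ ()) (keeps π₁ (λ ()) (redirect-sends ↔-refl _ _))
    sends (suc zero)       = keeps π₂ (λ ()) (redirect-sends π₁ _ _)
    sends (suc (suc zero)) = redirect-sends π₂ _ _

module _ {n c : ℕ} (f : Fin n → Fin c) where

  MonochromaticTriple : Set
  MonochromaticTriple = Σ (Fin 3 → Fin n) λ t → Injective _≡_ _≡_ t × ∀ r → f (t r) ≡ f (t zero)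

  private
    Repeat : Fin n → Set
    Repeat i = ∃[ k ] k Fin.< i × f k ≡ f i

    repeat? : ∀ i → Dec (Repeat i)
    repeat? i = Finₚ.any? λ k → (k Finₚ.<? i) ×-dec (f k Finₚ.≟ f i)

    bit : ∀ {X : Set} → Dec X → Fin 2
    bit (yes _) = suc zero
    bit (no _)  = zero

    fromRepeatedPair : ∀ {i j} → i Fin.< j → f i ≡ f j → (ri : Dec (Repeat i)) (rj : Dec (Repeat j)) →
                       bit ri ≡ bit rj → MonochromaticTriple
    fromRepeatedPair i<j fi≡fj _ (no ¬rj) _ = ⊥-elim (¬rj (_ , i<j , fi≡fj))
    fromRepeatedPair i<j fi≡fj (no _) (yes _) ()
    fromRepeatedPair {i} {j} i<j fi≡fj (yes (k , k<i , fk≡fi)) (yes _) _ =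
      triple k i j ,
      triple-injective (Finₚ.<⇒≢ k<i) (Finₚ.<⇒≢ (Finₚ.<-trans k<i i<j)) (Finₚ.<⇒≢ i<j) ,
      λ { zero → refl ; (suc zero) → sym fk≡fi ; (suc (suc zero)) → trans (sym fi≡fj) (sym fk≡fi) }

  -- Tag each point with whether an earlier point has its colour; the ordinary pigeonhole principle on
  -- these c * 2 tags yields i < j with equal tags, which forces a third point k < i of the same colour.
  pigeonhole₃ : c * 2 ℕ.< n → MonochromaticTriple
  pigeonhole₃ c*2<n =
    let (i , j , i<j , gi≡gj) = Finₚ.pigeonhole c*2<n (λ i → Fin.combine (f i) (bit (repeat? i)))
        (fi≡fj , bi≡bj)       = Finₚ.combine-injective (f i) _ (f j) _ gi≡gj
    in fromRepeatedPair i<j fi≡fj (repeat? i) (repeat? j) bi≡bj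

-- The system of order 6 and its layers

wheel : List (Star3 6)
wheel = star 0F 5F 1F 2F ∷ star 1F 5F 2F 3F ∷ star 2F 5F 3F 4F ∷ star 3F 5F 4F 0F ∷ star 4F 5F 0F 1F ∷ []

wellFormed? : ∀ {n} (s : Star3 n) → Dec (WellFormed s)
wellFormed? (star c a b d) =
  ¬? (c Finₚ.≟ a) ×-dec ¬? (c Finₚ.≟ b) ×-dec ¬? (c Finₚ.≟ d) ×-dec
  ¬? (a Finₚ.≟ b) ×-dec ¬? (a Finₚ.≟ d) ×-dec ¬? (b Finₚ.≟ d)

wheelSystem3 : StarSystem3 6
wheelSystem3 = record
  { blocks     = wheel
  ; wellFormed = toWitness {a? = All.all? wellFormed? wheel} _
  ; partition  = λ u v u≢v → [ ⊥-elim ∘ u≢v , (λ e → e) ]′ (partitions u v)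
  }
  where
  partitions : ∀ u v → u ≡ v ⊎ hasEdgeCount wheel u v ≡ 1
  partitions = toWitness {a? = Finₚ.all? λ u → Finₚ.all? λ v →
                                (u Finₚ.≟ v) ⊎-dec (hasEdgeCount wheel u v ℕₚ.≟ 1)} _

six : StarSystem (finType 6)
six = fromStarSystem3 wheelSystem3

upper : Fin 6 → Bool
upper 0F = true
upper 1F = true
upper 2F = false
upper 3F = true
upper 4F = false
upper 5F = false

open Transposition (Finₚ._≟_ {6}) using (transposition)

flipLayer raise₁ raise₂ : Fin 6 ↔ Fin 6
flipLayer = ↔-trans (transposition 0F 2F) (↔-trans (transposition 1F 4F) (transposition 3F 5F))
raise₁    = ↔-trans (transposition 1F 2F) (transposition 3F 4F)
raise₂    = transposition 1F 5F

flipLayer-flips : ∀ l → upper (Inverse.to flipLayer l) ≢ upper l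
flipLayer-flips = toWitness {a? = Finₚ.all? λ l → ¬? (upper (Inverse.to flipLayer l) ≟ᴮ upper l)} _

raise-raises : ∀ l → upper l ≡ false →
               upper (Inverse.to raise₁ l) ≡ true ⊎ upper (Inverse.to raise₂ l) ≡ true
raise-raises = toWitness {a? = Finₚ.all? λ l → (upper l ≟ᴮ false) →-dec
  ((upper (Inverse.to raise₁ l) ≟ᴮ true) ⊎-dec (upper (Inverse.to raise₂ l) ≟ᴮ true))} _

wheel-bichromatic : All (λ s → ∃[ r ] upper (leaf s r) ≢ upper (centre s)) (blocks six)
wheel-bichromatic = toWitness {a? = All.all? (λ s → Finₚ.any? λ r → ¬? (upper (leaf s r) ≟ᴮ upper (centre s)))
                                             (blocks six)} _

layerTwist : Bool → Bool → Fin 3 → Fin 6 ↔ Fin 6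
layerTwist true  _     = triple ↔-refl ↔-refl flipLayer
layerTwist false true  = triple ↔-refl raise₁ raise₂
layerTwist false false = λ _ → ↔-refl

layerTwist-fixes-0 : ∀ β r → Inverse.to (layerTwist false β r) 0F ≡ 0F
layerTwist-fixes-0 true  zero             = refl
layerTwist-fixes-0 true  (suc zero)       = refl
layerTwist-fixes-0 true  (suc (suc zero)) = refl
layerTwist-fixes-0 false _                = refl

sixPowerType : ℕ → FinType
sixPowerType ℕ.zero    = finType 1
sixPowerType (ℕ.suc j) = finType 6 ×ᶠ sixPowerType j

sixPower : ∀ j → StarSystem (sixPowerType j)
sixPower ℕ.zero    = record { blocks = [] ; isK₁₃ = [] ; partition = λ { zero zero 0≢0 → ⊥-elim (0≢0 refl) } }
sixPower (ℕ.suc j) = six ⊗ sixPower j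

size-sixPowerType : ∀ j → size (sixPowerType j) ≡ 6 ^ j
size-sixPowerType ℕ.zero    = refl
size-sixPowerType (ℕ.suc j) = cong (6 *_) (size-sixPowerType j)

suc≤6^ : ∀ m → ℕ.suc m ≤ 6 ^ m
suc≤6^ ℕ.zero    = ℕₚ.≤-refl
suc≤6^ (ℕ.suc m) = ℕₚ.≤-trans (ℕₚ.+-mono-≤ (ℕₚ.m^n>0 6 m) (suc≤6^ m))
                               (ℕₚ.+-monoʳ-≤ (6 ^ m) (ℕₚ.m≤n*m (6 ^ m) 5))

suc*2<6^suc : ∀ m → ℕ.suc m * 2 < 6 ^ ℕ.suc m
suc*2<6^suc m = begin-strict
  ℕ.suc m * 2  ≤⟨ ℕₚ.*-monoˡ-≤ 2 (suc≤6^ m) ⟩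
  6 ^ m * 2    <⟨ ℕₚ.*-monoʳ-< (6 ^ m) {{ℕₚ.m^n≢0 6 m}} (s≤s (s≤s (s≤s z≤n))) ⟩
  6 ^ m * 6    ≡⟨ ℕₚ.*-comm (6 ^ m) 6 ⟩
  6 ^ ℕ.suc m  ∎
  where open ℕₚ.≤-Reasoning

recolour : ∀ {m} → Bool → Fin m → Fin (ℕ.suc m)
recolour true  _ = Fin.fromℕ _
recolour false c = Fin.inject₁ c

recolour-level : ∀ {m} {β β′} {c c′ : Fin m} → recolour β c ≡ recolour β′ c′ → β ≡ β′
recolour-level {β = true}  {true}  _ = refl
recolour-level {β = true}  {false} e = ⊥-elim (Finₚ.fromℕ≢inject₁ e)
recolour-level {β = false} {true}  e = ⊥-elim (Finₚ.fromℕ≢inject₁ (sym e))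
recolour-level {β = false} {false} _ = refl

recolour-injective : ∀ {m} {β β′} {c c′ : Fin m} → β ≡ false → β′ ≡ false →
                     recolour β c ≡ recolour β′ c′ → c ≡ c′
recolour-injective refl refl = Finₚ.inject₁-injective

point : ∀ j → Carrier (sixPowerType j)
point ℕ.zero    = zero
point (ℕ.suc j) = zero , point j

module Construction {V : FinType} (S : StarSystem V) (j : ℕ) where

  E D I P Y Z : FinType
  E = sixPowerType j
  D = sixPowerType (ℕ.suc j)
  I = D ×ᶠ D ×ᶠ D
  P = V ×ᶠ I
  Y = P ⊎ᶠ D
  Z = Y ×ᶠ finType 6

  module Copies = TwistedProduct S (sixPower (ℕ.suc j) ⊗ sixPower (ℕ.suc j) ⊗ sixPower (ℕ.suc j))
                                   (λ _ _ _ → ↔-refl)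

  triples : (Carrier (finType 2 ×ᶠ E) × Fin 3) ↔ Carrier D
  triples = mk↔ₛ′ (λ { ((h , e) , r) → Fin.combine {2} {3} h r , e })
                  (λ { (x , e) → (proj₁ (Fin.remQuot {2} 3 x) , e) , proj₂ (Fin.remQuot {2} 3 x) })
                  (λ { (x , e) → cong (_, e) (Finₚ.combine-remQuot {2} 3 x) })
                  (λ { ((h , e) , r) → let hr≡ = Finₚ.remQuot-combine {2} {3} h r
                                       in cong₂ _,_ (cong (_, e) (cong proj₁ hr≡)) (cong proj₂ hr≡) })

  base : Fin 3 → Carrier D
  base r = Inverse.to triples ((zero , point j) , r)

  base-injective : Injective _≡_ _≡_ base
  base-injective {r} {r′} e =
    ,-injectiveʳ (↔-injective triples {(zero , point j) , r} {(zero , point j) , r′} e)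

  open Transposition (_≟_ D) using (sendTriple; sendTriple-sends)

  target : Carrier I → Fin 3 → Carrier D
  target (a , b , d) = triple a b d

  -- Every point p = (v , i) of P sees D cut into triples, arranged so that the triple (zero , point j)
  -- of p is exactly the triple i.
  opaque
    resolution : Carrier P → (Carrier (finType 2 ×ᶠ E) × Fin 3) ↔ Carrier D
    resolution (v , i) = ↔-trans triples (sendTriple base (target i))

    resolution-sends : ∀ v i → Injective _≡_ _≡_ (target i) →
                       ∀ r → Inverse.to (resolution (v , i)) ((zero , point j) , r) ≡ target i r
    resolution-sends v i target-injective = sendTriple-sends base-injective target-injective

  module Joined = Join {T = finType 2 ×ᶠ E} Copies.system (sixPower (ℕ.suc j)) resolution

  module Layered {m} (g : Carrier V → Fin (ℕ.suc m)) where

    ĝ : Carrier Y → Fin (ℕ.suc m)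
    ĝ (inj₁ (v , _)) = g v
    ĝ (inj₂ _)       = zero

    monochromatic? : ∀ b → Dec (IsMonochromatic ĝ b)
    monochromatic? b = Finₚ.all? λ r → ĝ (leaf b r) Finₚ.≟ ĝ (centre b)

    layering : Star (Carrier Y) → Fin 6 → Fin 3 → Fin 6 ↔ Fin 6
    layering b l = layerTwist (upper l) (does (monochromatic? b))

    module Layers = TwistedProduct Joined.system six layering

    layered : StarSystem Z
    layered = Layers.system

    extend : Carrier Z → Fin (ℕ.suc (ℕ.suc m))
    extend (y , l) = recolour (upper l) (ĝ y)

    module _ {s : Star (Carrier Z)} (mono : IsMonochromatic extend s) where

      monochromatic⇒sameLevel : ∀ r → upper (proj₂ (leaf s r)) ≡ upper (proj₂ (centre s))
      monochromatic⇒sameLevel r = recolour-level (mono r)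

      monochromatic⇒ĝ-monochromatic : upper (proj₂ (centre s)) ≡ false → IsMonochromatic ĝ (mapStar proj₁ s)
      monochromatic⇒ĝ-monochromatic lower r =
        recolour-injective (trans (monochromatic⇒sameLevel r) lower) lower (mono r)

    -- An upper centre has a leaf in a flipped layer, a lower centre of a ĝ-monochromatic star has a leaf
    -- in a raised layer; only the remaining stars keep all their leaves in one layer.
    sameLevel⇒lower-nonmonochromatic : ∀ {b} β (mono? : Dec (IsMonochromatic ĝ b)) l′ →
      (∀ r → upper (Inverse.to (layerTwist β (does mono?) r) l′) ≡ β) →
      β ≡ false × ¬ IsMonochromatic ĝ b
    sameLevel⇒lower-nonmonochromatic true  _       l′ same =
      ⊥-elim (flipLayer-flips l′ (trans (same (suc (suc zero))) (sym (same zero))))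
    sameLevel⇒lower-nonmonochromatic false (yes _) l′ same =
      ⊥-elim ([ lower-raised (suc zero) , lower-raised (suc (suc zero)) ]′ (raise-raises l′ (same zero)))
      where
      lower-raised : ∀ r → upper (Inverse.to (layerTwist false true r) l′) ≡ true → ⊥
      lower-raised r raised with () ← trans (sym raised) (same r)
    sameLevel⇒lower-nonmonochromatic false (no ¬mono) l′ same = refl , ¬mono

    extend-twistedStar : ∀ b ww → ¬ IsMonochromatic extend (Layers.twistedStar b ww)
    extend-twistedStar b (l , l′) mono =
      let (lower , ¬mono) = sameLevel⇒lower-nonmonochromatic {b} (upper l) (monochromatic? b) l′
                              (monochromatic⇒sameLevel {Layers.twistedStar b (l , l′)} mono)
      in ¬mono (monochromatic⇒ĝ-monochromatic {Layers.twistedStar b (l , l′)} mono lower)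

    extend-fibreStar : ∀ y {w} → ∃[ r ] upper (leaf w r) ≢ upper (centre w) →
                       ¬ IsMonochromatic extend (Layers.fibreStar y w)
    extend-fibreStar y {w} (r , differ) mono = differ (monochromatic⇒sameLevel {Layers.fibreStar y w} mono r)

    extend-colouring : Colouring layered (ℕ.suc (ℕ.suc m))
    extend-colouring = extend , ++⁺
      (concat⁺ (map⁺ (All.universal (λ b → map⁺ {f = Layers.twistedStar b}
                                              (All.universal (extend-twistedStar b) (enum (finType 6 ×ᶠ finType 6))))
                                    (blocks Joined.system))))
      (concat⁺ (map⁺ (All.universal (λ y → map⁺ {f = Layers.fibreStar y}
                                              (All.map (extend-fibreStar y) wheel-bichromatic))
                                    (enum Y))))

    layering-nonmonochromatic : ∀ {b} → ¬ IsMonochromatic ĝ b → ∀ r x →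
      Inverse.to (layerTwist false (does (monochromatic? b)) r) x ≡ x
    layering-nonmonochromatic {b} ¬mono r x =
      cong (λ β → Inverse.to (layerTwist false β r) x) (dec-false (monochromatic? b) ¬mono)

    module Recolouring (g-proper : All (¬_ ∘ IsMonochromatic g) (blocks S))
                       (φ : Carrier Z → Fin (ℕ.suc m))
                       (φ-proper : All (¬_ ∘ IsMonochromatic φ) (blocks layered))
                       (big : ℕ.suc m * 2 < size D) where

      open Inverse using (to)

      onD : Fin (size D) → Fin (ℕ.suc m)
      onD i = φ (inj₂ (Inverse.from (FinType.index D) i) , zero)

      monochromaticTriple : MonochromaticTriple onD
      monochromaticTriple = pigeonhole₃ onD big

      a : Fin 3 → Carrier D
      a r = Inverse.from (FinType.index D) (proj₁ monochromaticTriple r)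

      γ : Fin (ℕ.suc m)
      γ = φ (inj₂ (a zero) , zero)

      idx : Carrier I
      idx = a zero , a (suc zero) , a (suc (suc zero))

      target-idx : ∀ r → target idx r ≡ a r
      target-idx zero             = refl
      target-idx (suc zero)       = refl
      target-idx (suc (suc zero)) = refl

      target-injective : Injective _≡_ _≡_ (target idx)
      target-injective {r} {r′} e = proj₁ (proj₂ monochromaticTriple)
        (↔-injective (↔-sym (FinType.index D)) (trans (sym (target-idx r)) (trans e (target-idx r′))))

      recoloured : Carrier V → Fin (ℕ.suc m)
      recoloured v = φ (inj₁ (v , idx) , 2F)

      -- Otherwise the cross star from (v , idx) to the triple idx, placed in layers (2F , 0F), is monochromatic.
      recoloured≢γ : ∀ v → recoloured v ≢ γ
      recoloured≢γ v recoloured≡γ =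
        All.lookup φ-proper (Layers.twistedStar-∈ (Joined.crossStar-∈ pt) (2F , zero)) mono
        where
        pt : Carrier (P ×ᶠ finType 2 ×ᶠ E)
        pt = (v , idx) , (zero , point j)
        mono : IsMonochromatic φ (Layers.twistedStar (Joined.crossStar pt) (2F , zero))
        mono r = begin
          φ (inj₂ (to (resolution (v , idx)) ((zero , point j) , r)) , to (layering (Joined.crossStar pt) 2F r) zero)
            ≡⟨ cong₂ (λ x l → φ (inj₂ x , l)) (trans (resolution-sends v idx target-injective r) (target-idx r))
                                              (layerTwist-fixes-0 (does (monochromatic? (Joined.crossStar pt))) r) ⟩
          φ (inj₂ (a r) , zero)    ≡⟨ proj₂ (proj₂ monochromaticTriple) r ⟩
          γ                        ≡⟨ recoloured≡γ ⟨
          recoloured v             ∎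
          where open ≡-Reasoning

      -- A star of S sits, through the copy indexed by idx, in the lower layer 2F, untwisted since g is proper.
      recoloured-proper : All (¬_ ∘ IsMonochromatic recoloured) (blocks S)
      recoloured-proper = All.tabulate λ {b} b∈ mono →
        let b′ = mapStar inj₁ (Copies.twistedStar b (idx , idx))
            b′∈ = Joined.leftStar-∈ (Copies.twistedStar-∈ b∈ (idx , idx))
        in All.lookup φ-proper (Layers.twistedStar-∈ b′∈ (2F , 2F)) λ r →
             trans (cong (λ l → φ (inj₁ (leaf b r , idx) , l))
                         (layering-nonmonochromatic {b′} (All.lookup g-proper b∈) r 2F))
                   (mono r)

      recolouring : Colouring S m
      recolouring = colouring-missing {S = S} recoloured γ recoloured≢γ recoloured-proper

chromatic-step : ∀ {V m} (S : StarSystem V) → Colouring S (ℕ.suc m) → ¬ Colouring S m →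
                 ∃[ Z ] Σ (StarSystem Z) λ T → Colouring T (ℕ.suc (ℕ.suc m)) × ¬ Colouring T (ℕ.suc m)
chromatic-step {m = m} S (g , g-proper) ¬colouring =
  Z , layered , extend-colouring ,
  λ (φ , φ-proper) → ¬colouring (Recolouring.recolouring g-proper φ φ-proper big)
  where
  open Construction S m
  open Layered g
  big : ℕ.suc m * 2 < size D
  big = subst (ℕ.suc m * 2 <_) (sym (size-sixPowerType (ℕ.suc m))) (suc*2<6^suc m)


theorem2p3 : ∀ (k : ℕ) → 3 ≤ k →
    (∃[ n ] Σ (StarSystem3 n) λ S → Chromatic S (k ∸ 1)) →
    (∃[ m ] Σ (StarSystem3 m) λ T → Chromatic T k)
theorem2p3 ℕ.zero ()
theorem2p3 (ℕ.suc ℕ.zero) (s≤s ())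
theorem2p3 (ℕ.suc (ℕ.suc m)) _ (n , S , colourable , ¬colourable) =
  let (Z , T , colouring , ¬colouring) =
        chromatic-step (fromStarSystem3 S) (colouring-fromStarSystem3 {S = S} colourable)
                       (¬colourable ∘ colourable-fromStarSystem3 {S = S})
  in size Z , toStarSystem3 T ,
     colourable-toStarSystem3 {S = T} colouring , ¬colouring ∘ colouring-toStarSystem3 {S = T}
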